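{- $\mathrm{HNN}\subsetneq\overline{\mathrm{HNN}}$.
   Context: All classes are classes of families of Boolean functions $f_n:\{0,1\}^n\to\{0,1\}$; "polynomial" means polynomial in $n$. Let $\Delta(\mathbf{x},\mathbf{y})=\|\mathbf{x}-\mathbf{y}\|_2^2$. A Hamming nearest neighbor (HNN) representation of $f:\{0,1\}^n\to\{0,1\}$ is a pair of disjoint sets $P,N\subseteq\{0,1\}^n$ (anchors) such that $f(\mathbf{x})=1$ if some $\mathbf{p}\in P$ has $\Delta(\mathbf{x},\mathbf{p})<\Delta(\mathbf{x},\mathbf{q})$ for all $\mathbf{q}\in N$, and $f(\mathbf{x})=0$ if some $\mathbf{q}\in N$ has $\Delta(\mathbf{x},\mathbf{q})<\Delta(\mathbf{x},\mathbf{p})$ for all $\mathbf{p}\in P$. $\mathrm{HNN}$ is the class of functions with HNN representations using polynomially many anchors. A substitution of variables $v:\{0,1\}^n\to\{0,1\}^{\tilde n}$ outputs a vector each of whose coordinates is some $x_i$ (duplication allowed) or a constant; $f$ is a subfunction of $g:\{0,1\}^{\tilde n}\to\{0,1\}$ if $\tilde n=\mathrm{poly}(n)$ and $f=g\circ v$ for some substitution $v$. $\overline{\mathrm{HNN}}$ is the set of subfunctions of members of $\mathrm{HNN}$. -}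

module Defs where

open import Data.Nat using (ℕ; zero; suc; _+_; _*_; _^_; _≤_; _<_; ∣_-_∣)
open import Data.Bool using (Bool; true; false)
open import Data.Fin using (Fin)
open import Data.Vec using (Vec; []; _∷_; lookup; tabulate)
open import Data.List using (List; length)
open import Data.List.Membership.Propositional using (_∈_; _∉_)
open import Data.List.Relation.Unary.All using (All)
open import Data.List.Relation.Unary.Any using (Any)
open import Data.Sum using (_⊎_; inj₁; inj₂)
open import Data.Product using (Σ; ∃; _×_; _,_)
open import Relation.Binary.PropositionalEquality using (_≡_)
open import Function.Bundles using (_⇔_)

BoolFn : ℕ → Set
BoolFn n = Vec Bool n → Bool

Family : Set
Family = (n : ℕ) → BoolFn n

bit : Bool → ℕ
bit false = 0
bit true  = 1

Δ : ∀ {n} → Vec Bool n → Vec Bool n → ℕ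
Δ []       []       = 0
Δ (a ∷ xs) (b ∷ ys) = ∣ bit a - bit b ∣ * ∣ bit a - bit b ∣ + Δ xs ys

Nearer : ∀ {n} → Vec Bool n → List (Vec Bool n) → List (Vec Bool n) → Set
Nearer x A B = Any (λ a → All (λ b → Δ x a < Δ x b) B) A

record HNNRep {n : ℕ} (f : BoolFn n) : Set where
  field
    P        : List (Vec Bool n)
    N        : List (Vec Bool n)
    disjoint : ∀ {p} → p ∈ P → p ∉ N
    pos      : ∀ x → (f x ≡ true)  ⇔ Nearer x P N
    neg      : ∀ x → (f x ≡ false) ⇔ Nearer x N P

open HNNRep public

size : ∀ {n} {f : BoolFn n} → HNNRep f → ℕ
size r = length (P r) + length (N r)

poly : ℕ → ℕ → ℕ
poly c n = c * n ^ c + c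

HNN : Family → Set
HNN f = Σ ℕ λ c → ∀ n → Σ (HNNRep (f n)) λ r → size r ≤ poly c n

Substitution : ℕ → ℕ → Set
Substitution n m = Fin m → Fin n ⊎ Bool

applySubst : ∀ {n m} → Substitution n m → Vec Bool n → Vec Bool m
applySubst v x = tabulate λ j → entry (v j)
  where
  entry : _ → Bool
  entry (inj₁ i) = lookup x i
  entry (inj₂ b) = b

SubfunctionVia : ∀ {n m} → BoolFn n → BoolFn m → Set
SubfunctionVia {n} {m} f g = Σ (Substitution n m) λ v → ∀ x → f x ≡ g (applySubst v x)

HNNbar : Family → Set
HNNbar f = Σ Family λ g → HNN g × Σ ℕ λ c → ∀ n →
  Σ ℕ λ m → m ≤ poly c n × SubfunctionVia (f n) (g m)

-- HNN ⊆ HNN-bar through the identity substitution. Parity is not in HNN: in a representation of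
-- parity every point is an anchor, since a non-anchor could flip one bit towards its nearest anchor,
-- keeping its class but changing its parity; hence 2ⁿ anchors are needed. Yet parity is a
-- subfunction of a member of HNN: after copying the input n times and padding, n + 1 anchors
-- classified by weight parity make the anchor indexed by the weight of x the strictly nearest one.
module Submission where

open import Defs
open import Data.Product using (Σ; ∃; _×_; _,_; proj₂)
open import Relation.Nullary using (¬_; Dec; yes; no; contradiction)
open import Data.Bool as Bool using (Bool; true; false; not; _∧_; _xor_)
open import Data.Bool.Properties
  using (∧-idem; ∧-distribʳ-xor; true-xor; xor-same; xor-assoc; xor-identityʳ; not-distribˡ-xor;
         not-distribʳ-xor; xor-annihilates-not; not-injective; not-¬)
open import Data.Empty using (⊥-elim)
open import Data.Fin using (Fin; toℕ; fromℕ<)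
open import Data.Fin.Properties using (any?; toℕ-fromℕ<)
open import Data.List as List using (List; []; _∷_; length; filter; applyUpTo)
open import Data.List.Extrema.Nat using (argmin; argmin-sel; f[argmin]≤f[⊤]; f[argmin]≤f[xs])
open import Data.List.Membership.Propositional using (_∈_; _∉_; find; lose)
open import Data.List.Membership.Propositional.Properties
  using (∈-++⁺ˡ; ∈-++⁺ʳ; ∈-filter⁺; ∈-filter⁻; ∈-applyUpTo⁺; ∈-applyUpTo⁻)
open import Data.List.Properties using (length-++; length-filter; length-applyUpTo)
open import Data.List.Relation.Unary.All as All using (All; _∷_)
open import Data.List.Relation.Unary.Any as Any using (here; there)
open import Data.Nat using (ℕ; zero; suc; _+_; _*_; _∸_; _^_; _≤_; _<_; z≤n; s≤s; s≤s⁻¹; s<s⁻¹; _<?_; _≟_)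
open import Data.Nat.Properties
open import Algebra.Properties.CommutativeSemigroup +-commutativeSemigroup using (interchange; x∙yz≈y∙xz)
open import Data.Nat.Tactic.RingSolver using (solve-∀)
open import Data.Sum using (_⊎_; inj₁; inj₂; [_,_]′)
open import Data.Vec using (Vec; []; _∷_; _++_; replicate; concat; map; lookup; allFin)
open import Data.Vec.Properties using (≡-dec; tabulate∘lookup; map-++; map-concat; map-replicate; map-∘; map-lookup-allFin)
open import Function using (_∘_; id; _$_; flip)
open import Function.Bundles using (_⇔_; mk⇔; Equivalence)
open import Relation.Nullary.Decidable using (isYes; decidable-stable; map′)
open import Relation.Binary using (tri<; tri≈; tri>)
open import Relation.Binary.PropositionalEquality

open Equivalence using (to; from)

parity : ℕ → Bool
parity zero    = false
parity (suc n) = not (parity n)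

parity-+ : ∀ m n → parity (m + n) ≡ parity m xor parity n
parity-+ zero    n = refl
parity-+ (suc m) n = trans (cong not (parity-+ m n)) (not-distribˡ-xor (parity m) (parity n))

parity-* : ∀ m n → parity (m * n) ≡ parity m ∧ parity n
parity-* zero    n = refl
parity-* (suc m) n = begin
  parity (n + m * n)                 ≡⟨ parity-+ n (m * n) ⟩
  parity n xor parity (m * n)        ≡⟨ cong (parity n xor_) (parity-* m n) ⟩
  parity n xor (parity m ∧ parity n) ≡⟨ ∧-distribʳ-xor (parity n) true (parity m) ⟨
  (true xor parity m) ∧ parity n     ≡⟨ cong (_∧ parity n) (true-xor (parity m)) ⟩
  not (parity m) ∧ parity n          ∎
  where open ≡-Reasoning

parity-square : ∀ n → parity (n * n) ≡ parity n
parity-square n = trans (parity-* n n) (∧-idem (parity n))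

weight : ∀ {n} → Vec Bool n → ℕ
weight []      = 0
weight (b ∷ x) = bit b + weight x

weightParity : ∀ {n} → Vec Bool n → Bool
weightParity x = parity (weight x)

parityFamily : Family
parityFamily _ = weightParity

Δ-∷ : ∀ {n} a b (x y : Vec Bool n) → Δ (a ∷ x) (b ∷ y) ≡ bit (a xor b) + Δ x y
Δ-∷ true  true  x y = refl
Δ-∷ true  false x y = refl
Δ-∷ false true  x y = refl
Δ-∷ false false x y = refl

Δ-self : ∀ {n} (x : Vec Bool n) → Δ x x ≡ 0
Δ-self []          = refl
Δ-self (true ∷ x)  = Δ-self x
Δ-self (false ∷ x) = Δ-self x

bit-xor-triangle : ∀ a b c → bit (a xor c) ≤ bit (a xor b) + bit (b xor c)
bit-xor-triangle false false c     = ≤-refl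
bit-xor-triangle false true  false = z≤n
bit-xor-triangle false true  true  = s≤s z≤n
bit-xor-triangle true  false false = s≤s z≤n
bit-xor-triangle true  false true  = z≤n
bit-xor-triangle true  true  c     = ≤-refl

Δ-triangle : ∀ {n} (x y z : Vec Bool n) → Δ x z ≤ Δ x y + Δ y z
Δ-triangle []      []      []      = z≤n
Δ-triangle (a ∷ x) (b ∷ y) (c ∷ z) = begin
  Δ (a ∷ x) (c ∷ z)                                   ≡⟨ Δ-∷ a c x z ⟩
  bit (a xor c) + Δ x z                               ≤⟨ +-mono-≤ (bit-xor-triangle a b c) (Δ-triangle x y z) ⟩
  (bit (a xor b) + bit (b xor c)) + (Δ x y + Δ y z)   ≡⟨ interchange (bit (a xor b)) (bit (b xor c)) (Δ x y) (Δ y z) ⟩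
  (bit (a xor b) + Δ x y) + (bit (b xor c) + Δ y z)   ≡⟨ cong₂ _+_ (Δ-∷ a b x y) (Δ-∷ b c y z) ⟨
  Δ (a ∷ x) (b ∷ y) + Δ (b ∷ y) (c ∷ z)               ∎
  where open ≤-Reasoning

parity-Δ : ∀ {n} (x y : Vec Bool n) → parity (Δ x y) ≡ weightParity x xor weightParity y
parity-Δ []          []          = refl
parity-Δ (true ∷ x)  (true ∷ y)  = trans (parity-Δ x y) (sym (xor-annihilates-not (weightParity x) (weightParity y)))
parity-Δ (false ∷ x) (false ∷ y) = parity-Δ x y
parity-Δ (true ∷ x)  (false ∷ y) = trans (cong not (parity-Δ x y)) (not-distribˡ-xor (weightParity x) (weightParity y))
parity-Δ (false ∷ x) (true ∷ y)  = trans (cong not (parity-Δ x y)) (not-distribʳ-xor (weightParity x) (weightParity y))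

xor-cancelˡ : ∀ c {a b} → c xor a ≡ c xor b → a ≡ b
xor-cancelˡ false e = e
xor-cancelˡ true  e = not-injective e

Δ≡⇒weightParity≡ : ∀ {n} (y : Vec Bool n) {a b} → Δ y a ≡ Δ y b → weightParity a ≡ weightParity b
Δ≡⇒weightParity≡ y {a} {b} e =
  xor-cancelˡ (weightParity y) (trans (sym (parity-Δ y a)) (trans (cong parity e) (parity-Δ y b)))

step-towards : ∀ {n} (x a : Vec Bool n) → x ≢ a → ∃ λ y → Δ x y ≡ 1 × suc (Δ y a) ≡ Δ x a
step-towards []          []          x≢a = ⊥-elim (x≢a refl)
step-towards (true ∷ x)  (true ∷ a)  x≢a =
  let y , x~y , y-closer = step-towards x a (x≢a ∘ cong (true ∷_)) in true ∷ y , x~y , y-closer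
step-towards (false ∷ x) (false ∷ a) x≢a =
  let y , x~y , y-closer = step-towards x a (x≢a ∘ cong (false ∷_)) in false ∷ y , x~y , y-closer
step-towards (true ∷ x)  (false ∷ a) _   = false ∷ x , cong suc (Δ-self x) , refl
step-towards (false ∷ x) (true ∷ a)  _   = true ∷ x , cong suc (Δ-self x) , refl

adjacent-closer : ∀ {n} {x y a b : Vec Bool n} →
  Δ x y ≡ 1 → suc (Δ y a) ≡ Δ x a → Δ x a < Δ x b → Δ y a < Δ y b
adjacent-closer {x = x} {y} {a} {b} x~y y-closer a<b = s<s⁻¹ $ begin-strict
  suc (Δ y a)   ≡⟨ y-closer ⟩
  Δ x a         <⟨ a<b ⟩
  Δ x b         ≤⟨ Δ-triangle x y b ⟩
  Δ x y + Δ y b ≡⟨ cong (_+ Δ y b) x~y ⟩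
  suc (Δ y b)   ∎
  where open ≤-Reasoning

nearer-step : ∀ {n} {x : Vec Bool n} {A B} → x ∉ A → Nearer x A B → ∃ λ y → Δ x y ≡ 1 × Nearer y A B
nearer-step {x = x} x∉A x-nearer
  with a , a∈A , a-closest ← find x-nearer
  with y , x~y , y-closer ← step-towards x a (λ { refl → x∉A a∈A })
  = y , x~y , lose a∈A (All.map (adjacent-closer {x = x} {y} {a} x~y y-closer) a-closest)

-- A bit flip of an unanchored point towards its nearest anchor stays in the region but changes
-- the weight parity.
nearer-region-anchored : ∀ {n} {A B} {c} → (∀ {y : Vec Bool n} → Nearer y A B → weightParity y ≡ c) →
  ∀ {x} → Nearer x A B → x ∈ A
nearer-region-anchored {A = A} {c = c} region {x} x-nearer =
  decidable-stable (Any.any? (≡-dec Bool._≟_ x) A) λ x∉A →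
    let y , x~y , y-nearer = nearer-step x∉A x-nearer in
    (λ ()) $ begin
      true                                ≡⟨ cong parity x~y ⟨
      parity (Δ x y)                      ≡⟨ parity-Δ x y ⟩
      weightParity x xor weightParity y   ≡⟨ cong₂ _xor_ (region {x} x-nearer) (region {y} y-nearer) ⟩
      c xor c                             ≡⟨ xor-same c ⟩
      false                               ∎
  where open ≡-Reasoning

parity-anchored : ∀ {n} (r : HNNRep (parityFamily n)) x → x ∈ P r List.++ N r
parity-anchored r x with weightParity x in e
... | true  = ∈-++⁺ˡ (nearer-region-anchored (λ {y} → from (pos r y)) (to (pos r x) e))
... | false = ∈-++⁺ʳ (P r) (nearer-region-anchored (λ {y} → from (neg r y)) (to (neg r x) e))

2^suc : ∀ n → 2 ^ suc n ≡ 2 ^ n + 2 ^ n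
2^suc n = cong (2 ^ n +_) (+-identityʳ (2 ^ n))

tails : ∀ {n} → Bool → List (Vec Bool (suc n)) → List (Vec Bool n)
tails b     []                  = []
tails true  ((true ∷ x) ∷ L)    = x ∷ tails true L
tails true  ((false ∷ _) ∷ L)   = tails true L
tails false ((true ∷ _) ∷ L)    = tails false L
tails false ((false ∷ x) ∷ L)   = x ∷ tails false L

length-tails : ∀ {n} (L : List (Vec Bool (suc n))) → length (tails true L) + length (tails false L) ≡ length L
length-tails []                = refl
length-tails ((true ∷ _) ∷ L)  = cong suc (length-tails L)
length-tails ((false ∷ _) ∷ L) = trans (+-suc _ _) (cong suc (length-tails L))

∈-tails : ∀ {n} b {x : Vec Bool n} {L} → (b ∷ x) ∈ L → x ∈ tails b L
∈-tails true  {L = (true ∷ _) ∷ _}  (here refl) = here refl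
∈-tails false {L = (false ∷ _) ∷ _} (here refl) = here refl
∈-tails true  {L = (true ∷ _) ∷ _}  (there x∈L) = there (∈-tails true x∈L)
∈-tails true  {L = (false ∷ _) ∷ _} (there x∈L) = ∈-tails true x∈L
∈-tails false {L = (true ∷ _) ∷ _}  (there x∈L) = ∈-tails false x∈L
∈-tails false {L = (false ∷ _) ∷ _} (there x∈L) = there (∈-tails false x∈L)

covering-length : ∀ n (L : List (Vec Bool n)) → (∀ x → x ∈ L) → 2 ^ n ≤ length L
covering-length zero    []      covers with () ← covers []
covering-length zero    (_ ∷ _) _      = s≤s z≤n
covering-length (suc n) L       covers = begin
  2 ^ suc n                                      ≡⟨ 2^suc n ⟩
  2 ^ n + 2 ^ n                                  ≤⟨ +-mono-≤ (covering-length n _ (∈-tails true ∘ covers ∘ (true ∷_)))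
                                                             (covering-length n _ (∈-tails false ∘ covers ∘ (false ∷_))) ⟩
  length (tails true L) + length (tails false L) ≡⟨ length-tails L ⟩
  length L                                       ∎
  where open ≤-Reasoning

n<2^n : ∀ n → n < 2 ^ n
n<2^n zero    = s≤s z≤n
n<2^n (suc n) = ≤-trans (+-mono-≤ (m^n>0 2 n) (n<2^n n)) (≤-reflexive (sym (2^suc n)))

base≤power : ∀ {c n} → c < n → c ≤ n ^ c
base≤power {zero}  _                  = z≤n
base≤power {suc c} {n@(suc _)} c<n    = ≤-trans (<⇒≤ c<n) (m≤m*n n (n ^ c) {{m^n≢0 n c}})

poly≤power : ∀ {c n} → c < n → poly c n ≤ n ^ suc c
poly≤power {c} {n} c<n = begin
  c * n ^ c + c     ≤⟨ +-monoʳ-≤ (c * n ^ c) (base≤power c<n) ⟩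
  c * n ^ c + n ^ c ≡⟨ +-comm (c * n ^ c) (n ^ c) ⟩
  suc c * n ^ c     ≤⟨ *-monoˡ-≤ (n ^ c) c<n ⟩
  n * n ^ c         ∎
  where open ≤-Reasoning

-- Witness n = 2 ^ k with k = 2 ^ (d + 1): then n ^ d = 2 ^ (k * d) and k * d < 2 ^ k.
power<exponential : ∀ d → ∃ λ n → d < n × n ^ d < 2 ^ n
power<exponential d = n , <-trans d<k (n<2^n k) , n^d<2^n
  where
  open ≤-Reasoning
  k n : ℕ
  k = 2 ^ suc d
  n = 2 ^ k
  d<k : d < k
  d<k = <-≤-trans (n<2^n d) (^-monoʳ-≤ 2 (n≤1+n d))
  kd<2^k : k * d < 2 ^ k
  kd<2^k = begin-strict
    k * d           <⟨ *-monoʳ-< k {{m^n≢0 2 (suc d)}} (n<2^n d) ⟩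
    k * 2 ^ d       ≡⟨ ^-distribˡ-+-* 2 (suc d) d ⟨
    2 ^ (suc d + d) ≤⟨ ^-monoʳ-≤ 2 (≤-trans (+-mono-≤ (n<2^n d) (<⇒≤ (n<2^n d))) (≤-reflexive (sym (2^suc d)))) ⟩
    2 ^ k           ∎
  n^d<2^n : n ^ d < 2 ^ n
  n^d<2^n = begin-strict
    n ^ d       ≡⟨ ^-*-assoc 2 k d ⟩
    2 ^ (k * d) <⟨ ^-monoʳ-< 2 (s≤s (s≤s z≤n)) kd<2^k ⟩
    2 ^ n       ∎

poly<exponential : ∀ c → ∃ λ n → poly c n < 2 ^ n
poly<exponential c =
  let n , suc-c<n , n^suc-c<2^n = power<exponential (suc c)
  in n , ≤-<-trans (poly≤power (<-trans (n<1+n c) suc-c<n)) n^suc-c<2^n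

parity∉HNN : ¬ HNN parityFamily
parity∉HNN (c , reps) =
  let n , poly<2^n = poly<exponential c
      r , size≤poly = reps n
  in <-irrefl refl $ begin-strict
    2 ^ n               ≤⟨ covering-length n (P r List.++ N r) (parity-anchored r) ⟩
    length (P r List.++ N r) ≡⟨ length-++ (P r) ⟩
    size r              ≤⟨ size≤poly ⟩
    poly c n            <⟨ poly<2^n ⟩
    2 ^ n               ∎
  where open ≤-Reasoning

nearer? : ∀ {n} (y : Vec Bool n) A B → Dec (Nearer y A B)
nearer? y A B = Any.any? (λ a → All.all? (λ b → Δ y a <? Δ y b) B) A

nearer-asym : ∀ {n} {y : Vec Bool n} {A B} → Nearer y A B → ¬ Nearer y B A
nearer-asym y-nearer-A y-nearer-B
  with a , a∈A , a-closest ← find y-nearer-A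
  with b , b∈B , b-closest ← find y-nearer-B
  = <-asym (All.lookup a-closest b∈B) (All.lookup b-closest a∈A)

∃-argmin : ∀ {A : Set} (f : A → ℕ) {a : A} {xs} → a ∈ xs → ∃ λ b → b ∈ xs × All (λ c → f b ≤ f c) xs
∃-argmin f {xs = x ∷ xs} _ =
  argmin f x xs , [ (λ e → here e) , there ]′ (argmin-sel f x xs) ,
  f[argmin]≤f[⊤] {f = f} x xs ∷ f[argmin]≤f[xs] {f = f} x xs

isYes≡true⇔ : ∀ {A : Set} (d : Dec A) → isYes d ≡ true ⇔ A
isYes≡true⇔ (yes a) = mk⇔ (λ _ → a) (λ _ → refl)
isYes≡true⇔ (no ¬a) = mk⇔ (λ ()) (λ a → contradiction a ¬a)

isYes≡false⇔ : ∀ {A : Set} (d : Dec A) → isYes d ≡ false ⇔ (¬ A)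
isYes≡false⇔ (yes a) = mk⇔ (λ ()) (λ ¬a → contradiction a ¬a)
isYes≡false⇔ (no ¬a) = mk⇔ (λ _ → ¬a) (λ _ → refl)

-- Anchors are split into P and N by the parity of their weight (flipped by b), so Δ from any
-- point to a P-anchor and to an N-anchor differ in parity: the nearest-anchor rule never ties.
label : ∀ {m} → Bool → Vec Bool m → Bool
label b a = weightParity a xor b

label≟ : ∀ {m} b c (a : Vec Bool m) → Dec (label b a ≡ c)
label≟ b c a = label b a Bool.≟ c

parityClass : ∀ {m} → Bool → Bool → List (Vec Bool m) → List (Vec Bool m)
parityClass b c = filter (label≟ b c)

∈-parityClass⁻ : ∀ {m} b c {A} {a : Vec Bool m} → a ∈ parityClass b c A → a ∈ A × label b a ≡ c
∈-parityClass⁻ b c {A} = ∈-filter⁻ (label≟ b c) {xs = A}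

parityNN : ∀ {m} → Bool → List (Vec Bool m) → BoolFn m
parityNN b A y = isYes (nearer? y (parityClass b true A) (parityClass b false A))

nearer-parityClass : ∀ {m} b {A} {a y : Vec Bool m} → a ∈ A →
  (∀ {a'} → a' ∈ A → weightParity a' ≢ weightParity a → Δ y a < Δ y a') →
  Nearer y (parityClass b (label b a) A) (parityClass b (not (label b a)) A)
nearer-parityClass b {a = a} a∈A closest =
  lose (∈-filter⁺ (label≟ b (label b a)) a∈A refl) (All.tabulate λ a'∈ →
    let a'∈A , label-a' = ∈-parityClass⁻ b (not (label b a)) a'∈
    in closest a'∈A (λ same → not-¬ (cong (_xor b) same) label-a'))

parityNN-dichotomy : ∀ {m} b {A} {a : Vec Bool m} → a ∈ A → ∀ y →
  Nearer y (parityClass b true A) (parityClass b false A) ⊎ Nearer y (parityClass b false A) (parityClass b true A)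
parityNN-dichotomy b a∈A y
  with a , a∈A , a-min ← ∃-argmin (Δ y) a∈A
  with label b a | nearer-parityClass b {y = y} a∈A (λ a'∈A different →
         ≤∧≢⇒< (All.lookup a-min a'∈A) (different ∘ sym ∘ Δ≡⇒weightParity≡ y))
... | true  | y-nearer = inj₁ y-nearer
... | false | y-nearer = inj₂ y-nearer

parityNN-HNNRep : ∀ {m} b {A} {a : Vec Bool m} → a ∈ A → HNNRep (parityNN b A)
parityNN-HNNRep b {A} a∈A = record
  { P        = parityClass b true A
  ; N        = parityClass b false A
  ; disjoint = classes-disjoint
  ; pos      = λ y → isYes≡true⇔ (nearer? y _ _)
  ; neg      = λ y → mk⇔ (neg-to y) (from (isYes≡false⇔ (nearer? y _ _)) ∘ nearer-asym {y = y})
  }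
  where
  classes-disjoint : ∀ {p} → p ∈ parityClass b true A → p ∉ parityClass b false A
  classes-disjoint p∈P p∈N =
    contradiction (trans (sym (proj₂ (∈-parityClass⁻ b true {A} p∈P))) (proj₂ (∈-parityClass⁻ b false {A} p∈N))) λ ()
  neg-to : ∀ y → parityNN b A y ≡ false → Nearer y (parityClass b false A) (parityClass b true A)
  neg-to y e = [ flip contradiction (to (isYes≡false⇔ (nearer? y _ _)) e) , id ]′ (parityNN-dichotomy b a∈A y)

size-parityNN-HNNRep : ∀ {m} b {A} {a : Vec Bool m} (a∈A : a ∈ A) →
  size (parityNN-HNNRep b a∈A) ≤ length A + length A
size-parityNN-HNNRep b {A} _ = +-mono-≤ (length-filter (label≟ b true) A) (length-filter (label≟ b false) A)

parityNN-value : ∀ {m} b {A} {a y : Vec Bool m} → a ∈ A →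
  (∀ {a'} → a' ∈ A → weightParity a' ≢ weightParity a → Δ y a < Δ y a') →
  parityNN b A y ≡ label b a
parityNN-value b {A} {a} {y} a∈A closest with label b a | nearer-parityClass b {y = y} a∈A closest
... | true  | y-nearer = from (isYes≡true⇔ (nearer? y _ _)) y-nearer
... | false | y-nearer = from (isYes≡false⇔ (nearer? y _ _)) (nearer-asym {y = y} y-nearer)

evalEntry : ∀ {n} → Vec Bool n → Fin n ⊎ Bool → Bool
evalEntry x = [ lookup x , id ]′

applySubst-lookup : ∀ {n m} (t : Vec (Fin n ⊎ Bool) m) (x : Vec Bool n) → applySubst (lookup t) x ≡ map (evalEntry x) t
applySubst-lookup []           x = refl
applySubst-lookup (inj₁ i ∷ t) x = cong (lookup x i ∷_) (applySubst-lookup t x)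
applySubst-lookup (inj₂ b ∷ t) x = cong (b ∷_) (applySubst-lookup t x)

weight-++ : ∀ {k l} (u : Vec Bool k) (v : Vec Bool l) → weight (u ++ v) ≡ weight u + weight v
weight-++ []      v = refl
weight-++ (b ∷ u) v = trans (cong (bit b +_) (weight-++ u v)) (sym (+-assoc (bit b) (weight u) (weight v)))

weight-zeros : ∀ k → weight (replicate k false) ≡ 0
weight-zeros zero    = refl
weight-zeros (suc k) = weight-zeros k

weight-ones : ∀ k → weight (replicate k true) ≡ k
weight-ones zero    = refl
weight-ones (suc k) = cong suc (weight-ones k)

weight≤length : ∀ {k} (x : Vec Bool k) → weight x ≤ k
weight≤length []          = z≤n
weight≤length (true ∷ x)  = s≤s (weight≤length x)
weight≤length (false ∷ x) = m≤n⇒m≤1+n (weight≤length x)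

Δ-++ : ∀ {k l} (u u' : Vec Bool k) (v v' : Vec Bool l) → Δ (u ++ v) (u' ++ v') ≡ Δ u u' + Δ v v'
Δ-++ []      []        v v' = refl
Δ-++ (a ∷ u) (a' ∷ u') v v' =
  trans (cong (_ +_) (Δ-++ u u' v v')) (sym (+-assoc _ (Δ u u') (Δ v v')))

Δ-zerosˡ : ∀ {k} (x : Vec Bool k) → Δ (replicate k false) x ≡ weight x
Δ-zerosˡ []          = refl
Δ-zerosˡ (true ∷ x)  = cong suc (Δ-zerosˡ x)
Δ-zerosˡ (false ∷ x) = Δ-zerosˡ x

Δ-zerosʳ : ∀ {k} (x : Vec Bool k) → Δ x (replicate k false) ≡ weight x
Δ-zerosʳ []          = refl
Δ-zerosʳ (true ∷ x)  = cong suc (Δ-zerosʳ x)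
Δ-zerosʳ (false ∷ x) = Δ-zerosʳ x

Δ-ones : ∀ {k} (x : Vec Bool k) → Δ x (replicate k true) + weight x ≡ k
Δ-ones []          = refl
Δ-ones (true ∷ x)  = trans (+-suc (Δ x (replicate _ true)) (weight x)) (cong suc (Δ-ones x))
Δ-ones (false ∷ x) = cong suc (Δ-ones x)

unary : (k w : ℕ) → Vec Bool k
unary zero    w       = []
unary (suc k) zero    = false ∷ unary k zero
unary (suc k) (suc w) = true ∷ unary k w

weight-unary : ∀ {k w} → w ≤ k → weight (unary k w) ≡ w
weight-unary {zero}          z≤n     = refl
weight-unary {suc k} {zero}  z≤n     = weight-unary {k} z≤n
weight-unary {suc k} {suc w} (s≤s w≤k) = cong suc (weight-unary w≤k)

*-∸-split : ∀ {j n} → j ≤ n → j * n + n * (n ∸ j) ≡ n * n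
*-∸-split {j} {n} j≤n = begin
  j * n + n * (n ∸ j) ≡⟨ cong (_+ n * (n ∸ j)) (*-comm j n) ⟩
  n * j + n * (n ∸ j) ≡⟨ *-distribˡ-+ n j (n ∸ j) ⟨
  n * (j + (n ∸ j))   ≡⟨ cong (n *_) (m+[n∸m]≡n j≤n) ⟩
  n * n               ∎
  where open ≡-Reasoning

double-product<ˡ : ∀ {j w} → j < w → 2 * (j * w) < j * j + w * w
double-product<ˡ {j} j<w with k , refl ← m≤n⇒∃[o]m+o≡n j<w = begin-strict
  2 * (j * (suc j + k))                         <⟨ m<m+n _ (s≤s z≤n) ⟩
  2 * (j * (suc j + k)) + suc k * suc k         ≡⟨ square-expansion j k ⟩
  j * j + (suc j + k) * (suc j + k)             ∎
  where
  open ≤-Reasoning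
  square-expansion : ∀ j k → 2 * (j * (1 + j + k)) + (1 + k) * (1 + k) ≡ j * j + (1 + j + k) * (1 + j + k)
  square-expansion = solve-∀

double-product<sum-of-squares : ∀ {j w} → j ≢ w → 2 * (j * w) < j * j + w * w
double-product<sum-of-squares {j} {w} j≢w with <-cmp j w
... | tri< j<w _ _ = double-product<ˡ j<w
... | tri≈ _ j≡w _ = contradiction j≡w j≢w
... | tri> _ _ w<j = subst₂ _<_ (cong (2 *_) (*-comm w j)) (+-comm (w * w) (j * j)) (double-product<ˡ w<j)

-- The subtraction-free form of e = (j − w)² + (C − w²) and d = C − w².
closer-by-square : ∀ {d e j w C} → j ≢ w → e + 2 * (j * w) ≡ j * j + C → d + 2 * (w * w) ≡ w * w + C → d < e
closer-by-square {d} {e} {j} {w} {C} j≢w e-eq d-eq = +-cancelʳ-< (2 * (j * w)) d e $ begin-strict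
  d + 2 * (j * w)     <⟨ +-monoʳ-< d (double-product<sum-of-squares j≢w) ⟩
  d + (j * j + w * w) ≡⟨ x∙yz≈y∙xz d (j * j) (w * w) ⟩
  j * j + (d + w * w) ≡⟨ cong (j * j +_) C≡d+w² ⟨
  j * j + C           ≡⟨ e-eq ⟨
  e + 2 * (j * w)     ∎
  where
  open ≤-Reasoning
  double-square : ∀ d a → a + (d + a) ≡ d + 2 * a
  double-square = solve-∀
  C≡d+w² : C ≡ d + w * w
  C≡d+w² = sym (+-cancelˡ-≡ (w * w) (d + w * w) C (trans (double-square d (w * w)) d-eq))

gadgetDim : ℕ → ℕ
gadgetDim n = n * n + n * n

-- The input is n copies of x followed by n² zeros; anchor j has j blocks of ones, n − j blocks of
-- zeros and a tail of weight j² + n(n − j). Then Δ(input x, anchor j) = (j − w)² + n w + n² − w²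
-- for w = weight x, so anchor w is the unique nearest anchor, and its weight parity is w + n mod 2.
module Gadget (n : ℕ) where

  blocks : (k j : ℕ) → Vec Bool (k * n)
  blocks zero    j       = []
  blocks (suc k) zero    = replicate n false ++ blocks k zero
  blocks (suc k) (suc j) = replicate n true ++ blocks k j

  weight-blocks : ∀ {k j} → j ≤ k → weight (blocks k j) ≡ j * n
  weight-blocks {zero}          z≤n       = refl
  weight-blocks {suc k} {zero}  _         =
    trans (weight-++ (replicate n false) (blocks k 0)) (cong₂ _+_ (weight-zeros n) (weight-blocks {k} z≤n))
  weight-blocks {suc k} {suc j} (s≤s j≤k) =
    trans (weight-++ (replicate n true) (blocks k j)) (cong₂ _+_ (weight-ones n) (weight-blocks j≤k))

  Δ-copies-blocks : ∀ (x : Vec Bool n) {k j} → j ≤ k →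
    Δ (concat (replicate k x)) (blocks k j) + j * weight x ≡ j * Δ x (replicate n true) + k * weight x
  Δ-copies-blocks x {zero}          z≤n       = refl
  Δ-copies-blocks x {suc k} {zero}  _         = begin
    Δ (x ++ xs) (replicate n false ++ blocks k 0) + 0 ≡⟨ +-identityʳ _ ⟩
    Δ (x ++ xs) (replicate n false ++ blocks k 0)     ≡⟨ Δ-++ x _ xs _ ⟩
    Δ x (replicate n false) + Δ xs (blocks k 0)      ≡⟨ cong₂ _+_ (Δ-zerosʳ x) rest ⟩
    weight x + k * weight x                          ∎
    where
    open ≡-Reasoning
    xs = concat (replicate k x)
    rest : Δ xs (blocks k 0) ≡ k * weight x
    rest = trans (sym (+-identityʳ _)) (Δ-copies-blocks x {k} z≤n)
  Δ-copies-blocks x {suc k} {suc j} (s≤s j≤k) = begin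
    Δ (x ++ xs) (replicate n true ++ blocks k j) + (w + j * w) ≡⟨ cong (_+ (w + j * w)) (Δ-++ x _ xs _) ⟩
    (D + R) + (w + j * w)                                     ≡⟨ interchange D R w (j * w) ⟩
    (D + w) + (R + j * w)                                     ≡⟨ cong ((D + w) +_) (Δ-copies-blocks x j≤k) ⟩
    (D + w) + (j * D + k * w)                                 ≡⟨ interchange D w (j * D) (k * w) ⟩
    (D + j * D) + (w + k * w)                                 ∎
    where
    open ≡-Reasoning
    xs = concat (replicate k x)
    w = weight x
    D = Δ x (replicate n true)
    R = Δ xs (blocks k j)

  tailWeight : ℕ → ℕ
  tailWeight j = j * j + n * (n ∸ j)

  tailWeight≤ : ∀ {j} → j ≤ n → tailWeight j ≤ n * n
  tailWeight≤ {j} j≤n = ≤-trans (+-monoˡ-≤ (n * (n ∸ j)) (*-monoʳ-≤ j j≤n)) (≤-reflexive (*-∸-split j≤n))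

  input : Vec Bool n → Vec Bool (gadgetDim n)
  input x = concat (replicate n x) ++ replicate (n * n) false

  anchor : ℕ → Vec Bool (gadgetDim n)
  anchor j = blocks n j ++ unary (n * n) (tailWeight j)

  anchors : List (Vec Bool (gadgetDim n))
  anchors = applyUpTo anchor (suc n)

  gadget : BoolFn (gadgetDim n)
  gadget = parityNN (parity n) anchors

  weight-anchor : ∀ {j} → j ≤ n → weight (anchor j) ≡ j * j + n * n
  weight-anchor {j} j≤n = begin
    weight (anchor j)                  ≡⟨ weight-++ (blocks n j) _ ⟩
    weight (blocks n j) + weight (unary (n * n) (tailWeight j)) ≡⟨ cong₂ _+_ (weight-blocks j≤n) (weight-unary (tailWeight≤ j≤n)) ⟩
    j * n + (j * j + n * (n ∸ j))      ≡⟨ x∙yz≈y∙xz (j * n) (j * j) (n * (n ∸ j)) ⟩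
    j * j + (j * n + n * (n ∸ j))      ≡⟨ cong (j * j +_) (*-∸-split j≤n) ⟩
    j * j + n * n                      ∎
    where open ≡-Reasoning

  label-anchor : ∀ {j} → j ≤ n → label (parity n) (anchor j) ≡ parity j
  label-anchor {j} j≤n = begin
    parity (weight (anchor j)) xor parity n     ≡⟨ cong (λ s → parity s xor parity n) (weight-anchor j≤n) ⟩
    parity (j * j + n * n) xor parity n         ≡⟨ cong (_xor parity n) (parity-+ (j * j) (n * n)) ⟩
    (parity (j * j) xor parity (n * n)) xor parity n ≡⟨ cong₂ (λ a b → (a xor b) xor parity n) (parity-square j) (parity-square n) ⟩
    (parity j xor parity n) xor parity n        ≡⟨ xor-assoc (parity j) (parity n) (parity n) ⟩
    parity j xor (parity n xor parity n)        ≡⟨ cong (parity j xor_) (xor-same (parity n)) ⟩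
    parity j xor false                          ≡⟨ xor-identityʳ (parity j) ⟩
    parity j                                    ∎
    where open ≡-Reasoning

  Δ-input-anchor : ∀ (x : Vec Bool n) {j} → j ≤ n →
    Δ (input x) (anchor j) + 2 * (j * weight x) ≡ j * j + (n * weight x + n * n)
  Δ-input-anchor x {j} j≤n = begin
    Δ (input x) (anchor j) + 2 * (j * w)              ≡⟨ cong (_+ 2 * (j * w)) (Δ-++ xs (blocks n j) _ _) ⟩
    (R + Δ (replicate (n * n) false) tail) + 2 * (j * w) ≡⟨ cong (λ p → (R + p) + 2 * (j * w)) Δ-tail ⟩
    (R + (j * j + n * t)) + 2 * (j * w)               ≡⟨ split-cross-term R (j * j + n * t) (j * w) ⟩
    (R + j * w) + (j * w + (j * j + n * t))           ≡⟨ cong (_+ (j * w + (j * j + n * t))) (Δ-copies-blocks x j≤n) ⟩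
    (j * D + n * w) + (j * w + (j * j + n * t))       ≡⟨ collect j D n w t ⟩
    j * j + (n * w + (j * (D + w) + n * t))           ≡⟨ cong (λ s → j * j + (n * w + (j * s + n * t))) (Δ-ones x) ⟩
    j * j + (n * w + (j * n + n * t))                 ≡⟨ cong (λ s → j * j + (n * w + s)) (*-∸-split j≤n) ⟩
    j * j + (n * w + n * n)                           ∎
    where
    open ≡-Reasoning
    xs = concat (replicate n x)
    tail = unary (n * n) (tailWeight j)
    t = n ∸ j
    w = weight x
    D = Δ x (replicate n true)
    R = Δ xs (blocks n j)
    Δ-tail : Δ (replicate (n * n) false) tail ≡ tailWeight j
    Δ-tail = trans (Δ-zerosˡ tail) (weight-unary (tailWeight≤ j≤n))
    split-cross-term : ∀ R a c → (R + a) + 2 * c ≡ (R + c) + (c + a)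
    split-cross-term = solve-∀
    collect : ∀ j D n w t →
      (j * D + n * w) + (j * w + (j * j + n * t)) ≡ j * j + (n * w + (j * (D + w) + n * t))
    collect = solve-∀

  anchor-weight-nearest : ∀ (x : Vec Bool n) {j} → j ≤ n → j ≢ weight x →
    Δ (input x) (anchor (weight x)) < Δ (input x) (anchor j)
  anchor-weight-nearest x j≤n j≢w = closer-by-square j≢w (Δ-input-anchor x j≤n) (Δ-input-anchor x (weight≤length x))

  gadget-input : ∀ x → gadget (input x) ≡ weightParity x
  gadget-input x = trans (parityNN-value (parity n) {y = input x} (∈-applyUpTo⁺ anchor (s≤s w≤n)) nearest) (label-anchor w≤n)
    where
    w≤n = weight≤length x
    nearest : ∀ {a} → a ∈ anchors → weightParity a ≢ weightParity (anchor (weight x)) →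
      Δ (input x) (anchor (weight x)) < Δ (input x) a
    nearest a∈ different with j , j<1+n , refl ← ∈-applyUpTo⁻ anchor a∈ =
      anchor-weight-nearest x (s≤s⁻¹ j<1+n) λ { refl → different refl }

  inputTemplate : Vec (Fin n ⊎ Bool) (gadgetDim n)
  inputTemplate = concat (replicate n (map inj₁ (allFin n))) ++ replicate (n * n) (inj₂ false)

  applySubst-inputTemplate : ∀ x → applySubst (lookup inputTemplate) x ≡ input x
  applySubst-inputTemplate x = begin
    applySubst (lookup inputTemplate) x                                    ≡⟨ applySubst-lookup inputTemplate x ⟩
    map ev (concat (replicate n row) ++ zeros)                             ≡⟨ map-++ ev (concat (replicate n row)) zeros ⟩
    map ev (concat (replicate n row)) ++ map ev zeros                      ≡⟨ cong₂ _++_ copies (map-replicate ev (inj₂ false) (n * n)) ⟩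
    input x                                                                ∎
    where
    open ≡-Reasoning
    ev = evalEntry x
    row = map inj₁ (allFin n)
    zeros = replicate (n * n) (inj₂ false)
    copies : map ev (concat (replicate n row)) ≡ concat (replicate n x)
    copies = begin
      map ev (concat (replicate n row))          ≡⟨ map-concat ev (replicate n row) ⟩
      concat (map (map ev) (replicate n row))    ≡⟨ cong concat (map-replicate (map ev) row n) ⟩
      concat (replicate n (map ev row))          ≡⟨ cong (concat ∘ replicate n) (sym (map-∘ ev inj₁ (allFin n))) ⟩
      concat (replicate n (map (lookup x) (allFin n))) ≡⟨ cong (concat ∘ replicate n) (map-lookup-allFin x) ⟩
      concat (replicate n x)                     ∎

  gadgetRep : Σ (HNNRep gadget) λ r → size r ≤ suc n + suc n
  gadgetRep = r , subst (λ l → size r ≤ l + l) (length-applyUpTo anchor (suc n))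
                        (size-parityNN-HNNRep (parity n) anchor0∈)
    where
    anchor0∈ = ∈-applyUpTo⁺ anchor (s≤s z≤n)
    r = parityNN-HNNRep (parity n) anchor0∈

gadgetDim-mono-< : ∀ {m n} → m < n → gadgetDim m < gadgetDim n
gadgetDim-mono-< m<n = +-mono-< (*-mono-< m<n m<n) (*-mono-< m<n m<n)

gadgetDim-injective : ∀ {m n} → gadgetDim m ≡ gadgetDim n → m ≡ n
gadgetDim-injective {m} {n} e with <-cmp m n
... | tri< m<n _ _ = contradiction e (<⇒≢ (gadgetDim-mono-< m<n))
... | tri≈ _ m≡n _ = m≡n
... | tri> _ _ n<m = contradiction (sym e) (<⇒≢ (gadgetDim-mono-< n<m))

n≤gadgetDim : ∀ n → n ≤ gadgetDim n
n≤gadgetDim zero        = z≤n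
n≤gadgetDim n@(suc _)   = ≤-trans (m≤m*n n n) (m≤m+n (n * n) (n * n))

gadgetDim? : ∀ m → Dec (∃ λ n → gadgetDim n ≡ m)
gadgetDim? m = map′ (λ (i , e) → toℕ i , e) bounded (any? λ (i : Fin (suc m)) → gadgetDim (toℕ i) ≟ m)
  where
  bounded : ∃ (λ n → gadgetDim n ≡ m) → ∃ λ (i : Fin (suc m)) → gadgetDim (toℕ i) ≡ m
  bounded (n , e) = fromℕ< n<1+m , trans (cong gadgetDim (toℕ-fromℕ< n<1+m)) e
    where
    n<1+m : n < suc m
    n<1+m = s≤s (subst (n ≤_) e (n≤gadgetDim n))

-- Dimensions that are not of the form 2n² get an arbitrary (constant) function.
familyAt : ∀ m → Dec (∃ λ n → gadgetDim n ≡ m) → BoolFn m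
familyAt .(gadgetDim n) (yes (n , refl)) = Gadget.gadget n
familyAt m              (no _)           = parityNN false (replicate m false ∷ [])

gadgetFamily : Family
gadgetFamily m = familyAt m (gadgetDim? m)

m≤m^2 : ∀ m → m ≤ m ^ 2
m≤m^2 zero        = z≤n
m≤m^2 m@(suc _)   = m≤m*n m (m ^ 1)

2+2n≤poly2 : ∀ {n m} → n ≤ m → suc n + suc n ≤ poly 2 m
2+2n≤poly2 {n} {m} n≤m = begin
  suc n + suc n ≡⟨ double n ⟩
  2 * n + 2     ≤⟨ +-monoˡ-≤ 2 (*-monoʳ-≤ 2 (≤-trans n≤m (m≤m^2 m))) ⟩
  2 * m ^ 2 + 2 ∎
  where
  open ≤-Reasoning
  double : ∀ n → (1 + n) + (1 + n) ≡ 2 * n + 2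
  double = solve-∀

gadgetFamily∈HNN : HNN gadgetFamily
gadgetFamily∈HNN = 2 , λ m → rep m (gadgetDim? m)
  where
  rep : ∀ m d → Σ (HNNRep (familyAt m d)) λ r → size r ≤ poly 2 m
  rep .(gadgetDim n) (yes (n , refl)) =
    let r , size≤ = Gadget.gadgetRep n in r , ≤-trans size≤ (2+2n≤poly2 (n≤gadgetDim n))
  rep m (no _) = parityNN-HNNRep false zeros∈ ,
    ≤-trans (size-parityNN-HNNRep false zeros∈) (2+2n≤poly2 {m = m} z≤n)
    where
    zeros∈ : replicate m false ∈ replicate m false ∷ []
    zeros∈ = here refl

familyAt-gadgetDim : ∀ n d → familyAt (gadgetDim n) d ≡ Gadget.gadget n
familyAt-gadgetDim n (no ¬p)       = contradiction (n , refl) ¬p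
familyAt-gadgetDim n (yes (k , e)) with refl ← gadgetDim-injective {k} {n} e rewrite ≡-irrelevant e refl = refl

parity-subfunction : ∀ n → SubfunctionVia (parityFamily n) (gadgetFamily (gadgetDim n))
parity-subfunction n = lookup inputTemplate , λ x → begin
  weightParity x                      ≡⟨ gadget-input x ⟨
  gadget (input x)                    ≡⟨ cong gadget (applySubst-inputTemplate x) ⟨
  gadget (substituted x)              ≡⟨ cong (λ g → g (substituted x)) (familyAt-gadgetDim n (gadgetDim? (gadgetDim n))) ⟨
  gadgetFamily (gadgetDim n) (substituted x) ∎
  where
  open ≡-Reasoning
  open Gadget n
  substituted : Vec Bool n → Vec Bool (gadgetDim n)
  substituted = applySubst (lookup inputTemplate)

gadgetDim≤poly2 : ∀ n → gadgetDim n ≤ poly 2 n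
gadgetDim≤poly2 n = ≤-trans (≤-reflexive (twice-square n)) (m≤m+n (2 * n ^ 2) 2)
  where
  twice-square : ∀ n → n * n + n * n ≡ 2 * (n * (n * 1))
  twice-square = solve-∀

HNN⊆HNNbar : ∀ f → HNN f → HNNbar f
HNN⊆HNNbar f f∈HNN = f , f∈HNN , 2 , λ n →
  n , ≤-trans (≤-trans (n≤1+n n) (m≤m+n (suc n) (suc n))) (2+2n≤poly2 {n} ≤-refl) ,
  inj₁ , λ x → cong (f n) (sym (tabulate∘lookup x))

parity∈HNNbar : HNNbar parityFamily
parity∈HNNbar = gadgetFamily , gadgetFamily∈HNN , 2 , λ n → gadgetDim n , gadgetDim≤poly2 n , parity-subfunction n

corollary1 : ((f : Family) → HNN f → HNNbar f)
             × Σ Family (λ f → HNNbar f × ¬ HNN f)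
corollary1 = HNN⊆HNNbar , parityFamily , parity∈HNNbar , parity∉HNN
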